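{- Let $(G,\circ)$ be a finite abelian group with identity $1$, let $\emptyset\ne A\subseteq G$, and let $B\subseteq G$ be an $A$-packing set of maximal size (i.e. $|A\circ B|=|A||B|$ and $|B|=\nu(A)$). Then $$\mathrm{Sym}(B)=\mathrm{Sym}(B\circ B^{ -1}),$$ and $$\mathrm{Sym}(A\circ A^{ -1})\cap (A\circ A^{ -1})=\bigl(\mathrm{Sym}(A\circ A^{ -1})\setminus \mathrm{Sym}(B)\bigr)\sqcup\{1\},$$ where $\sqcup$ denotes a union of two disjoint sets.
   Context: For subsets $A,B\subseteq G$: $A\circ B=\{a\circ b:a\in A,b\in B\}$ and $A\circ A^{ -1}=\{a\circ b^{ -1}:a,b\in A\}$. $B$ is an $A$-packing set if $|A\circ B|=|A||B|$, and $\nu(A)$ is the maximal size of an $A$-packing set. For $T\subseteq G$, $\mathrm{Sym}(T)=\{x\in G: x\circ T=T\}$ is the group of symmetries of $T$. -}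

module Defs where

open import Data.Nat using (ℕ; _*_; _≤_)
open import Data.Bool using (Bool)
import Data.Bool as Bool
open import Data.Fin using (Fin)
import Data.Fin as Fin
open import Data.Fin.Properties using (any?)
open import Data.Fin.Subset using (Subset; _∈_; ∣_∣; _∩_; Empty; ⁅_⁆)
open import Data.Fin.Subset.Properties using (_∈?_)
open import Data.Vec using (tabulate)
open import Data.Vec.Properties using (≡-dec)
open import Data.Product using (_×_)
open import Relation.Nullary using (does)
open import Relation.Nullary.Decidable using (_×-dec_)
open import Relation.Binary.PropositionalEquality using (_≡_)
open import Algebra.Structures using (IsAbelianGroup)

-- A finite abelian group, presented (up to isomorphism) on the carrier Fin n,
-- with propositional equality.
record FinAbGroup (n : ℕ) : Set where
  infixl 7 _∘_
  field
    _∘_ : Fin n → Fin n → Fin n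
    one : Fin n
    inv : Fin n → Fin n
    isAbelianGroup : IsAbelianGroup _≡_ _∘_ one inv

module _ {n : ℕ} (G : FinAbGroup n) where
  open FinAbGroup G

  _⊙_ : Subset n → Subset n → Subset n
  A ⊙ B = tabulate λ x →
    does (any? λ a → any? λ b → (a ∈? A) ×-dec ((b ∈? B) ×-dec (x Fin.≟ a ∘ b)))

  Inv : Subset n → Subset n
  Inv B = tabulate λ x → does (any? λ b → (b ∈? B) ×-dec (x Fin.≟ inv b))

  Diff : Subset n → Subset n
  Diff A = A ⊙ Inv A

  IsPacking : Subset n → Subset n → Set
  IsPacking A B = ∣ A ⊙ B ∣ ≡ ∣ A ∣ * ∣ B ∣

  IsMaxPacking : Subset n → Subset n → Set
  IsMaxPacking A B = IsPacking A B × (∀ (C : Subset n) → IsPacking A C → ∣ C ∣ ≤ ∣ B ∣)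

  Sym : Subset n → Subset n
  Sym T = tabulate λ x → does (≡-dec Bool._≟_ (⁅ x ⁆ ⊙ T) T)

  Disjoint : Subset n → Subset n → Set
  Disjoint P Q = Empty (P ∩ Q)

-- An A-packing set B is one whose translates A ∘ b (b ∈ B) are pairwise disjoint: counting
-- A ∘ B one element of B at a time, |A ∘ B| = |A| |B| exactly when a ∘ b = a′ ∘ b′ forces b = b′.
-- If x stabilises B ∘ B⁻¹, the translates of B ∪ x ∘ B are still pairwise disjoint, because a
-- collision between A ∘ c and A ∘ (x ∘ t) has quotient x ∘ t ∘ c⁻¹ ∈ B ∘ B⁻¹ and so comes from a
-- collision inside B. Maximality of B then gives x ∘ B ⊆ B, so Sym(B ∘ B⁻¹) ⊆ Sym(B); the reverse
-- inclusion holds for every B. For the second identity, if y = a ∘ a′⁻¹ fixes B then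
-- a′ ∘ (y ∘ b) = a ∘ b is a collision, so y = 1; and Sym(A ∘ A⁻¹) ⊆ A ∘ A⁻¹ since 1 ∈ A ∘ A⁻¹.

module Submission where

open import Defs
open import Data.Nat using (ℕ)
open import Data.Fin.Subset using (Subset; Nonempty; _∩_; _∪_; _─_; ⁅_⁆)
open import Data.Product using (_×_)
open import Relation.Binary.PropositionalEquality using (_≡_)

open import Data.Nat using (suc; _+_; _*_; _≤_)
open import Data.Nat.Properties
  using ( +-suc; +-comm; +-identityʳ; *-suc; *-zeroʳ; +-cancelˡ-≡; +-cancelˡ-≤; +-monoʳ-≤
        ; m≤m+n; ≤-antisym; ≤-reflexive; <⇒≱; <-irrefl; module ≤-Reasoning)
import Data.Bool as Bool
open import Data.Fin using (Fin; _≟_)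
open import Data.Fin.Subset using (inside; outside; ⊥; _∈_; _∉_; _⊆_; _⊂_; ∣_∣; Empty; _-_)
open import Data.Fin.Subset.Properties
open import Data.Fin.Subset.Induction using (⊂-wellFounded)
open import Data.Fin.Properties using (any?)
open import Data.Vec using ([]; _∷_; here; there; tabulate)
open import Data.Vec.Properties using (lookup∘tabulate; []=⇒lookup; lookup⇒[]=; ≡-dec)
open import Data.Product using (∃; ∃₂; _,_; proj₁; proj₂)
open import Data.Sum using (inj₁; inj₂)
open import Induction.WellFounded using (WfRec; module All)
open import Relation.Nullary using (Dec; yes; no; does; contradiction)
open import Relation.Nullary.Decidable using (dec-true; _×-dec_)
open import Relation.Binary.PropositionalEquality
  using (refl; sym; trans; cong; subst; subst₂; module ≡-Reasoning)
open import Algebra.Bundles using (AbelianGroup)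
open import Algebra.Structures using (IsAbelianGroup)
import Algebra.Properties.AbelianGroup as AbelianGroupProperties
import Algebra.Properties.CommutativeSemigroup as CommutativeSemigroupProperties

private
  variable
    n : ℕ

module _ {P : Fin n → Set} (P? : ∀ x → Dec (P x)) {x : Fin n} where

  ∈-tabulate⁻ : x ∈ tabulate (λ y → does (P? y)) → P x
  ∈-tabulate⁻ x∈ with P? x | trans (sym (lookup∘tabulate _ x)) ([]=⇒lookup x∈)
  ... | yes px | _ = px
  ... | no _   | ()

  ∈-tabulate⁺ : P x → x ∈ tabulate (λ y → does (P? y))
  ∈-tabulate⁺ px = lookup⇒[]= x _ (trans (lookup∘tabulate _ x) (dec-true (P? x) px))

x∈p─q⇒x∉q : ∀ (p q : Subset n) {x} → x ∈ p ─ q → x ∉ q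
x∈p─q⇒x∉q (_ ∷ p) (outside ∷ q) here ()
x∈p─q⇒x∉q (_ ∷ p) (_ ∷ q) (there x∈p─q) (there x∈q) = x∈p─q⇒x∉q p q x∈p─q x∈q

x∉p-x : ∀ (p : Subset n) x → x ∉ p - x
x∉p-x p x x∈p-x = x∈p─q⇒x∉q p ⁅ x ⁆ x∈p-x (x∈⁅x⁆ x)

p-x∪⁅x⁆≡p : ∀ {p : Subset n} {x} → x ∈ p → (p - x) ∪ ⁅ x ⁆ ≡ p
p-x∪⁅x⁆≡p {p = p} {x} x∈p = ⊆-antisym ⊆p p⊆
  where
  ⊆p : (p - x) ∪ ⁅ x ⁆ ⊆ p
  ⊆p y∈ with x∈p∪q⁻ (p - x) ⁅ x ⁆ y∈
  ... | inj₁ y∈p-x = p─q⊆p p ⁅ x ⁆ y∈p-x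
  ... | inj₂ y∈⁅x⁆ = subst (_∈ p) (sym (x∈⁅y⁆⇒x≡y x y∈⁅x⁆)) x∈p
  p⊆ : p ⊆ (p - x) ∪ ⁅ x ⁆
  p⊆ {y} y∈p with y ≟ x
  ... | yes refl = x∈p∪q⁺ (inj₂ (x∈⁅x⁆ x))
  ... | no y≢x = x∈p∪q⁺ (inj₁ (x∈p∧x∉q⇒x∈p─q y∈p (x≢y⇒x∉⁅y⁆ y≢x)))

x∈q⇒Empty[p─q∩⁅x⁆] : ∀ (p q : Subset n) {x} → x ∈ q → Empty ((p ─ q) ∩ ⁅ x ⁆)
x∈q⇒Empty[p─q∩⁅x⁆] p q {x} x∈q (y , y∈) with x∈p∩q⁻ (p ─ q) ⁅ x ⁆ y∈
... | y∈p─q , y∈⁅x⁆ = x∈p─q⇒x∉q p q y∈p─q (subst (_∈ q) (sym (x∈⁅y⁆⇒x≡y x y∈⁅x⁆)) x∈q)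

Empty⇒∣p∣≡0 : ∀ {p : Subset n} → Empty p → ∣ p ∣ ≡ 0
Empty⇒∣p∣≡0 {n} p-empty = trans (cong ∣_∣ (Empty-unique p-empty)) (∣⊥∣≡0 n)

∣p∣≡0⇒Empty : ∀ {p : Subset n} → ∣ p ∣ ≡ 0 → Empty p
∣p∣≡0⇒Empty {n} ∣p∣≡0 (x , x∈p) =
  <-irrefl (trans (∣⊥∣≡0 n) (sym ∣p∣≡0)) (p⊂q⇒∣p∣<∣q∣ (⊥⊆ , x , x∈p , ∉⊥))

∣p∪q∣+∣p∩q∣≡∣p∣+∣q∣ : ∀ (p q : Subset n) → ∣ p ∪ q ∣ + ∣ p ∩ q ∣ ≡ ∣ p ∣ + ∣ q ∣
∣p∪q∣+∣p∩q∣≡∣p∣+∣q∣ [] [] = refl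
∣p∪q∣+∣p∩q∣≡∣p∣+∣q∣ (inside ∷ p) (inside ∷ q) = cong suc (begin
  ∣ p ∪ q ∣ + suc ∣ p ∩ q ∣  ≡⟨ +-suc ∣ p ∪ q ∣ ∣ p ∩ q ∣ ⟩
  suc (∣ p ∪ q ∣ + ∣ p ∩ q ∣) ≡⟨ cong suc (∣p∪q∣+∣p∩q∣≡∣p∣+∣q∣ p q) ⟩
  suc (∣ p ∣ + ∣ q ∣)         ≡⟨ +-suc ∣ p ∣ ∣ q ∣ ⟨
  ∣ p ∣ + suc ∣ q ∣           ∎)
  where open ≡-Reasoning
∣p∪q∣+∣p∩q∣≡∣p∣+∣q∣ (inside ∷ p) (outside ∷ q) = cong suc (∣p∪q∣+∣p∩q∣≡∣p∣+∣q∣ p q)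
∣p∪q∣+∣p∩q∣≡∣p∣+∣q∣ (outside ∷ p) (inside ∷ q) =
  trans (cong suc (∣p∪q∣+∣p∩q∣≡∣p∣+∣q∣ p q)) (sym (+-suc ∣ p ∣ ∣ q ∣))
∣p∪q∣+∣p∩q∣≡∣p∣+∣q∣ (outside ∷ p) (outside ∷ q) = ∣p∪q∣+∣p∩q∣≡∣p∣+∣q∣ p q

∣p∪⁅x⁆∣≡1+∣p∣ : ∀ {p : Subset n} {x} → x ∉ p → ∣ p ∪ ⁅ x ⁆ ∣ ≡ suc ∣ p ∣
∣p∪⁅x⁆∣≡1+∣p∣ {p = p} {x} x∉p = begin
  ∣ p ∪ ⁅ x ⁆ ∣                    ≡⟨ +-identityʳ _ ⟨
  ∣ p ∪ ⁅ x ⁆ ∣ + 0                ≡⟨ cong (∣ p ∪ ⁅ x ⁆ ∣ +_) (Empty⇒∣p∣≡0 p∩⁅x⁆-empty) ⟨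
  ∣ p ∪ ⁅ x ⁆ ∣ + ∣ p ∩ ⁅ x ⁆ ∣    ≡⟨ ∣p∪q∣+∣p∩q∣≡∣p∣+∣q∣ p ⁅ x ⁆ ⟩
  ∣ p ∣ + ∣ ⁅ x ⁆ ∣                ≡⟨ cong (∣ p ∣ +_) (∣⁅x⁆∣≡1 x) ⟩
  ∣ p ∣ + 1                        ≡⟨ +-comm ∣ p ∣ 1 ⟩
  suc ∣ p ∣                        ∎
  where
  open ≡-Reasoning
  p∩⁅x⁆-empty : Empty (p ∩ ⁅ x ⁆)
  p∩⁅x⁆-empty (y , y∈) with x∈p∩q⁻ p ⁅ x ⁆ y∈
  ... | y∈p , y∈⁅x⁆ = x∉p (subst (_∈ p) (x∈⁅y⁆⇒x≡y x y∈⁅x⁆) y∈p)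

insertion-induction : (Q : Subset n → Set) → Q ⊥
  → (∀ p x → x ∉ p → Q p → Q (p ∪ ⁅ x ⁆)) → ∀ p → Q p
insertion-induction Q Q⊥ Q-insert = All.wfRec ⊂-wellFounded _ Q step
  where
  step : ∀ p → WfRec _⊂_ Q p → Q p
  step p rec with nonempty? p
  ... | no p-empty = subst Q (sym (Empty-unique p-empty)) Q⊥
  ... | yes (x , x∈p) =
    subst Q (p-x∪⁅x⁆≡p x∈p) (Q-insert (p - x) x (x∉p-x p x) (rec (x∈p⇒p-x⊂p x∈p)))

+-squeeze : ∀ {u i x m} a → u + i ≡ a + x → x ≤ m → u ≡ a + m → x ≡ m × i ≡ 0
+-squeeze {u} {i} {x} {m} a u+i≡a+x x≤m u≡a+m = x≡m , i≡0
  where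
  m≤x : m ≤ x
  m≤x = +-cancelˡ-≤ a m x (begin
    a + m  ≡⟨ u≡a+m ⟨
    u      ≤⟨ m≤m+n u i ⟩
    u + i  ≡⟨ u+i≡a+x ⟩
    a + x  ∎)
    where open ≤-Reasoning
  x≡m : x ≡ m
  x≡m = ≤-antisym x≤m m≤x
  i≡0 : i ≡ 0
  i≡0 = +-cancelˡ-≡ u i 0 (begin
    u + i  ≡⟨ u+i≡a+x ⟩
    a + x  ≡⟨ cong (a +_) x≡m ⟩
    a + m  ≡⟨ u≡a+m ⟨
    u      ≡⟨ +-identityʳ u ⟨
    u + 0  ∎)
    where open ≡-Reasoning

module _ {n : ℕ} (G : FinAbGroup n) where
  open FinAbGroup G
  open IsAbelianGroup isAbelianGroup using (assoc; comm; identityˡ; identityʳ; inverseʳ)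

  private
    abelianGroup : AbelianGroup _ _
    abelianGroup = record
      { Carrier = Fin n ; _≈_ = _≡_ ; _∙_ = _∘_ ; ε = one ; _⁻¹ = inv
      ; isAbelianGroup = isAbelianGroup }

  open AbelianGroupProperties abelianGroup
    using ( ∙-cancelˡ; ∙-cancelʳ; \\-leftDividesˡ; \\-leftDividesʳ; //-rightDividesˡ; //-rightDividesʳ
          ; ε⁻¹≈ε; x∙y⁻¹≈ε⇒x≈y)
  open CommutativeSemigroupProperties (AbelianGroup.commutativeSemigroup abelianGroup)
    using (x∙yz≈y∙xz)

  infixl 8 _·_
  _·_ : Subset n → Subset n → Subset n
  _·_ = _⊙_ G

  private
    -- Must be definitionally the deciders tabulated in _⊙_, Inv and Sym.
    ·-decide : ∀ A C x → Dec (∃₂ λ a c → a ∈ A × c ∈ C × x ≡ a ∘ c)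
    ·-decide A C x = any? λ a → any? λ c → (a ∈? A) ×-dec ((c ∈? C) ×-dec (x ≟ a ∘ c))

    Inv-decide : ∀ B x → Dec (∃ λ b → b ∈ B × x ≡ inv b)
    Inv-decide B x = any? λ b → (b ∈? B) ×-dec (x ≟ inv b)

    Sym-decide : ∀ T x → Dec (⁅ x ⁆ · T ≡ T)
    Sym-decide T x = ≡-dec Bool._≟_ (⁅ x ⁆ · T) T

  ∈·⁻ : ∀ {A C x} → x ∈ A · C → ∃₂ λ a c → a ∈ A × c ∈ C × x ≡ a ∘ c
  ∈·⁻ {A} {C} = ∈-tabulate⁻ (·-decide A C)

  ∈·⁺ : ∀ {A C a c} → a ∈ A → c ∈ C → a ∘ c ∈ A · C
  ∈·⁺ {A} {C} a∈A c∈C = ∈-tabulate⁺ (·-decide A C) (_ , _ , a∈A , c∈C , refl)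

  ∈⁅x⁆·⁻ : ∀ {x C y} → y ∈ ⁅ x ⁆ · C → ∃ λ c → c ∈ C × y ≡ x ∘ c
  ∈⁅x⁆·⁻ {x} y∈ with ∈·⁻ y∈
  ... | x′ , c , x′∈⁅x⁆ , c∈C , refl = c , c∈C , cong (_∘ c) (x∈⁅y⁆⇒x≡y x x′∈⁅x⁆)

  ∈Diff⁻ : ∀ {B x} → x ∈ Diff G B → ∃₂ λ b b′ → b ∈ B × b′ ∈ B × x ≡ b ∘ inv b′
  ∈Diff⁻ {B} x∈ with ∈·⁻ x∈
  ... | b , z , b∈B , z∈B⁻¹ , refl with ∈-tabulate⁻ (Inv-decide B) z∈B⁻¹
  ... | b′ , b′∈B , refl = b , b′ , b∈B , b′∈B , refl

  ∈Diff⁺ : ∀ {B b b′} → b ∈ B → b′ ∈ B → b ∘ inv b′ ∈ Diff G B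
  ∈Diff⁺ {B} b∈B b′∈B = ∈·⁺ b∈B (∈-tabulate⁺ (Inv-decide B) (_ , b′∈B , refl))

  Stable : Fin n → Subset n → Set
  Stable x T = ∀ {y} → y ∈ T → x ∘ y ∈ T

  ∈Sym⁻ : ∀ {T x} → x ∈ Sym G T → Stable x T × Stable (inv x) T
  ∈Sym⁻ {T} {x} x∈ = x-stable , x⁻¹-stable
    where
    ⁅x⁆·T≡T : ⁅ x ⁆ · T ≡ T
    ⁅x⁆·T≡T = ∈-tabulate⁻ (Sym-decide T) x∈
    x-stable : Stable x T
    x-stable y∈T = subst (_ ∈_) ⁅x⁆·T≡T (∈·⁺ (x∈⁅x⁆ x) y∈T)
    x⁻¹-stable : Stable (inv x) T
    x⁻¹-stable y∈T with ∈⁅x⁆·⁻ (subst (_ ∈_) (sym ⁅x⁆·T≡T) y∈T)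
    ... | t , t∈T , refl = subst (_∈ T) (sym (\\-leftDividesʳ x t)) t∈T

  ∈Sym⁺ : ∀ {T x} → Stable x T → Stable (inv x) T → x ∈ Sym G T
  ∈Sym⁺ {T} {x} x-stable x⁻¹-stable =
    ∈-tabulate⁺ (Sym-decide T) (⊆-antisym ⁅x⁆·T⊆T T⊆⁅x⁆·T)
    where
    ⁅x⁆·T⊆T : ⁅ x ⁆ · T ⊆ T
    ⁅x⁆·T⊆T y∈ with ∈⁅x⁆·⁻ y∈
    ... | t , t∈T , refl = x-stable t∈T
    T⊆⁅x⁆·T : T ⊆ ⁅ x ⁆ · T
    T⊆⁅x⁆·T {y} y∈T = subst (_∈ ⁅ x ⁆ · T) (\\-leftDividesˡ x y) (∈·⁺ (x∈⁅x⁆ x) (x⁻¹-stable y∈T))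

  one∈Sym : ∀ (T : Subset n) → one ∈ Sym G T
  one∈Sym T = ∈Sym⁺ one-stable (λ y∈T → subst (λ e → e ∘ _ ∈ T) (sym ε⁻¹≈ε) (one-stable y∈T))
    where
    one-stable : Stable one T
    one-stable {y} y∈T = subst (_∈ T) (sym (identityˡ y)) y∈T

  Stable⇒∈ : ∀ {T x} → Stable x T → one ∈ T → x ∈ T
  Stable⇒∈ {T} {x} x-stable one∈T = subst (_∈ T) (identityʳ x) (x-stable one∈T)

  one∈Diff : ∀ {A} → Nonempty A → one ∈ Diff G A
  one∈Diff (a , a∈A) = subst (_∈ Diff G _) (inverseʳ a) (∈Diff⁺ a∈A a∈A)

  Empty[A·⊥] : ∀ {A} → Empty (A · ⊥)
  Empty[A·⊥] (_ , x∈) with ∈·⁻ x∈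
  ... | _ , _ , _ , c∈⊥ , _ = ∉⊥ c∈⊥

  ·-comm : ∀ (A C : Subset n) → A · C ≡ C · A
  ·-comm A C = ⊆-antisym (swap A C) (swap C A)
    where
    swap : ∀ A C → A · C ⊆ C · A
    swap A C x∈ with ∈·⁻ x∈
    ... | a , c , a∈A , c∈C , refl = subst (_∈ C · A) (comm c a) (∈·⁺ c∈C a∈A)

  ·-distribˡ-∪ : ∀ (A C D : Subset n) → A · (C ∪ D) ≡ A · C ∪ A · D
  ·-distribˡ-∪ A C D = ⊆-antisym ⊆∪ ∪⊆
    where
    ⊆∪ : A · (C ∪ D) ⊆ A · C ∪ A · D
    ⊆∪ x∈ with ∈·⁻ x∈
    ... | a , c , a∈A , c∈C∪D , refl with x∈p∪q⁻ C D c∈C∪D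
    ... | inj₁ c∈C = x∈p∪q⁺ (inj₁ (∈·⁺ a∈A c∈C))
    ... | inj₂ c∈D = x∈p∪q⁺ (inj₂ (∈·⁺ a∈A c∈D))
    ∪⊆ : A · C ∪ A · D ⊆ A · (C ∪ D)
    ∪⊆ x∈ with x∈p∪q⁻ (A · C) (A · D) x∈
    ... | inj₁ x∈A·C with ∈·⁻ x∈A·C
    ...   | _ , _ , a∈A , c∈C , refl = ∈·⁺ a∈A (x∈p∪q⁺ (inj₁ c∈C))
    ∪⊆ x∈ | inj₂ x∈A·D with ∈·⁻ x∈A·D
    ...   | _ , _ , a∈A , c∈D , refl = ∈·⁺ a∈A (x∈p∪q⁺ (inj₂ c∈D))

  ⁅x⁆·⁅y⁆≡⁅x∘y⁆ : ∀ x y → ⁅ x ⁆ · ⁅ y ⁆ ≡ ⁅ x ∘ y ⁆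
  ⁅x⁆·⁅y⁆≡⁅x∘y⁆ x y = ⊆-antisym ⊆⁅x∘y⁆ (λ z∈ → subst (_∈ ⁅ x ⁆ · ⁅ y ⁆) (sym (x∈⁅y⁆⇒x≡y _ z∈)) (∈·⁺ (x∈⁅x⁆ x) (x∈⁅x⁆ y)))
    where
    ⊆⁅x∘y⁆ : ⁅ x ⁆ · ⁅ y ⁆ ⊆ ⁅ x ∘ y ⁆
    ⊆⁅x∘y⁆ z∈ with ∈⁅x⁆·⁻ z∈
    ... | y′ , y′∈⁅y⁆ , refl = subst (λ w → x ∘ w ∈ ⁅ x ∘ y ⁆) (sym (x∈⁅y⁆⇒x≡y y y′∈⁅y⁆)) (x∈⁅x⁆ (x ∘ y))

  ∣⁅x⁆·A∣≡∣A∣ : ∀ x (A : Subset n) → ∣ ⁅ x ⁆ · A ∣ ≡ ∣ A ∣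
  ∣⁅x⁆·A∣≡∣A∣ x = insertion-induction _ (trans (Empty⇒∣p∣≡0 Empty[A·⊥]) (sym (∣⊥∣≡0 n))) step
    where
    step : ∀ A a → a ∉ A → ∣ ⁅ x ⁆ · A ∣ ≡ ∣ A ∣ → ∣ ⁅ x ⁆ · (A ∪ ⁅ a ⁆) ∣ ≡ ∣ A ∪ ⁅ a ⁆ ∣
    step A a a∉A ih = begin
      ∣ ⁅ x ⁆ · (A ∪ ⁅ a ⁆) ∣           ≡⟨ cong ∣_∣ (·-distribˡ-∪ ⁅ x ⁆ A ⁅ a ⁆) ⟩
      ∣ ⁅ x ⁆ · A ∪ ⁅ x ⁆ · ⁅ a ⁆ ∣     ≡⟨ cong (λ S → ∣ ⁅ x ⁆ · A ∪ S ∣) (⁅x⁆·⁅y⁆≡⁅x∘y⁆ x a) ⟩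
      ∣ ⁅ x ⁆ · A ∪ ⁅ x ∘ a ⁆ ∣         ≡⟨ ∣p∪⁅x⁆∣≡1+∣p∣ x∘a∉⁅x⁆·A ⟩
      suc ∣ ⁅ x ⁆ · A ∣                 ≡⟨ cong suc ih ⟩
      suc ∣ A ∣                         ≡⟨ ∣p∪⁅x⁆∣≡1+∣p∣ a∉A ⟨
      ∣ A ∪ ⁅ a ⁆ ∣                     ∎
      where
      open ≡-Reasoning
      x∘a∉⁅x⁆·A : x ∘ a ∉ ⁅ x ⁆ · A
      x∘a∉⁅x⁆·A x∘a∈ with ∈⁅x⁆·⁻ x∘a∈
      ... | a′ , a′∈A , x∘a≡x∘a′ = a∉A (subst (_∈ A) (sym (∙-cancelˡ x a a′ x∘a≡x∘a′)) a′∈A)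

  ∣A·[C∪⁅c⁆]∣+∣A·C∩A·⁅c⁆∣≡∣A∣+∣A·C∣ : ∀ (A C : Subset n) c →
    ∣ A · (C ∪ ⁅ c ⁆) ∣ + ∣ A · C ∩ A · ⁅ c ⁆ ∣ ≡ ∣ A ∣ + ∣ A · C ∣
  ∣A·[C∪⁅c⁆]∣+∣A·C∩A·⁅c⁆∣≡∣A∣+∣A·C∣ A C c = begin
    ∣ A · (C ∪ ⁅ c ⁆) ∣ + ∣ A · C ∩ A · ⁅ c ⁆ ∣  ≡⟨ cong (λ S → ∣ S ∣ + ∣ A · C ∩ A · ⁅ c ⁆ ∣) (·-distribˡ-∪ A C ⁅ c ⁆) ⟩
    ∣ A · C ∪ A · ⁅ c ⁆ ∣ + ∣ A · C ∩ A · ⁅ c ⁆ ∣ ≡⟨ ∣p∪q∣+∣p∩q∣≡∣p∣+∣q∣ (A · C) (A · ⁅ c ⁆) ⟩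
    ∣ A · C ∣ + ∣ A · ⁅ c ⁆ ∣                     ≡⟨ cong (λ S → ∣ A · C ∣ + ∣ S ∣) (·-comm A ⁅ c ⁆) ⟩
    ∣ A · C ∣ + ∣ ⁅ c ⁆ · A ∣                     ≡⟨ cong (∣ A · C ∣ +_) (∣⁅x⁆·A∣≡∣A∣ c A) ⟩
    ∣ A · C ∣ + ∣ A ∣                             ≡⟨ +-comm ∣ A · C ∣ ∣ A ∣ ⟩
    ∣ A ∣ + ∣ A · C ∣                             ∎
    where open ≡-Reasoning

  Separated : Subset n → Subset n → Subset n → Set
  Separated A C D = ∀ {a a′ c d} → a ∈ A → a′ ∈ A → c ∈ C → d ∈ D → a ∘ c ≡ a′ ∘ d → c ≡ d

  DisjointTranslates : Subset n → Subset n → Set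
  DisjointTranslates A C = Separated A C C

  DisjointTranslates-⊆ : ∀ {A C D} → C ⊆ D → DisjointTranslates A D → DisjointTranslates A C
  DisjointTranslates-⊆ C⊆D D-disjoint a∈A a′∈A c∈C c′∈C = D-disjoint a∈A a′∈A (C⊆D c∈C) (C⊆D c′∈C)

  DisjointTranslates-⁅⁆ : ∀ {A x} → DisjointTranslates A ⁅ x ⁆
  DisjointTranslates-⁅⁆ {x = x} _ _ c∈⁅x⁆ c′∈⁅x⁆ _ = trans (x∈⁅y⁆⇒x≡y x c∈⁅x⁆) (sym (x∈⁅y⁆⇒x≡y x c′∈⁅x⁆))

  DisjointTranslates-⁅x⁆· : ∀ {A C} x → DisjointTranslates A C → DisjointTranslates A (⁅ x ⁆ · C)
  DisjointTranslates-⁅x⁆· {A} {C} x C-disjoint {a} {a′} a∈A a′∈A c∈ c′∈ e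
    with ∈⁅x⁆·⁻ c∈ | ∈⁅x⁆·⁻ c′∈
  ... | t , t∈C , refl | t′ , t′∈C , refl = cong (x ∘_) (C-disjoint a∈A a′∈A t∈C t′∈C a∘t≡a′∘t′)
    where
    a∘t≡a′∘t′ : a ∘ t ≡ a′ ∘ t′
    a∘t≡a′∘t′ = ∙-cancelˡ x _ _ (trans (sym (x∙yz≈y∙xz a x t)) (trans e (x∙yz≈y∙xz a′ x t′)))

  DisjointTranslates-∪ : ∀ {A C D} → DisjointTranslates A C → DisjointTranslates A D → Separated A C D
    → DisjointTranslates A (C ∪ D)
  DisjointTranslates-∪ {C = C} {D} C-disjoint D-disjoint C-D-separated a∈A a′∈A c∈ c′∈ e
    with x∈p∪q⁻ C D c∈ | x∈p∪q⁻ C D c′∈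
  ... | inj₁ c∈C | inj₁ c′∈C = C-disjoint a∈A a′∈A c∈C c′∈C e
  ... | inj₁ c∈C | inj₂ c′∈D = C-D-separated a∈A a′∈A c∈C c′∈D e
  ... | inj₂ c∈D | inj₁ c′∈C = sym (C-D-separated a′∈A a∈A c′∈C c∈D (sym e))
  ... | inj₂ c∈D | inj₂ c′∈D = D-disjoint a∈A a′∈A c∈D c′∈D e

  ∣A∣*∣C∪⁅c⁆∣≡∣A∣+∣A∣*∣C∣ : ∀ (A : Subset n) {C : Subset n} {c} → c ∉ C → ∣ A ∣ * ∣ C ∪ ⁅ c ⁆ ∣ ≡ ∣ A ∣ + ∣ A ∣ * ∣ C ∣
  ∣A∣*∣C∪⁅c⁆∣≡∣A∣+∣A∣*∣C∣ A {C} c∉C = trans (cong (∣ A ∣ *_) (∣p∪⁅x⁆∣≡1+∣p∣ c∉C)) (*-suc ∣ A ∣ ∣ C ∣)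

  ⊥-packing : ∀ (A : Subset n) → IsPacking G A ⊥
  ⊥-packing A = begin
    ∣ A · ⊥ ∣       ≡⟨ Empty⇒∣p∣≡0 Empty[A·⊥] ⟩
    0               ≡⟨ *-zeroʳ ∣ A ∣ ⟨
    ∣ A ∣ * 0       ≡⟨ cong (∣ A ∣ *_) (∣⊥∣≡0 n) ⟨
    ∣ A ∣ * ∣ ⊥ {n} ∣   ∎
    where open ≡-Reasoning

  ∣A·C∣≤∣A∣*∣C∣ : ∀ (A C : Subset n) → ∣ A · C ∣ ≤ ∣ A ∣ * ∣ C ∣
  ∣A·C∣≤∣A∣*∣C∣ A = insertion-induction _ (≤-reflexive (⊥-packing A)) step
    where
    step : ∀ C c → c ∉ C → ∣ A · C ∣ ≤ ∣ A ∣ * ∣ C ∣ → ∣ A · (C ∪ ⁅ c ⁆) ∣ ≤ ∣ A ∣ * ∣ C ∪ ⁅ c ⁆ ∣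
    step C c c∉C ih = begin
      ∣ A · (C ∪ ⁅ c ⁆) ∣                         ≤⟨ m≤m+n _ _ ⟩
      ∣ A · (C ∪ ⁅ c ⁆) ∣ + ∣ A · C ∩ A · ⁅ c ⁆ ∣ ≡⟨ ∣A·[C∪⁅c⁆]∣+∣A·C∩A·⁅c⁆∣≡∣A∣+∣A·C∣ A C c ⟩
      ∣ A ∣ + ∣ A · C ∣                           ≤⟨ +-monoʳ-≤ ∣ A ∣ ih ⟩
      ∣ A ∣ + ∣ A ∣ * ∣ C ∣                       ≡⟨ ∣A∣*∣C∪⁅c⁆∣≡∣A∣+∣A∣*∣C∣ A c∉C ⟨
      ∣ A ∣ * ∣ C ∪ ⁅ c ⁆ ∣                       ∎
      where open ≤-Reasoning

  packing⇒DisjointTranslates : ∀ (A C : Subset n) → IsPacking G A C → DisjointTranslates A C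
  packing⇒DisjointTranslates A = insertion-induction _ (λ _ _ _ c∈⊥ _ _ → contradiction c∈⊥ ∉⊥) step
    where
    step : ∀ C c → c ∉ C → (IsPacking G A C → DisjointTranslates A C)
      → IsPacking G A (C ∪ ⁅ c ⁆) → DisjointTranslates A (C ∪ ⁅ c ⁆)
    step C c c∉C ih packing = DisjointTranslates-∪ (ih C-packing) DisjointTranslates-⁅⁆ C-c-separated
      where
      squeezed : IsPacking G A C × ∣ A · C ∩ A · ⁅ c ⁆ ∣ ≡ 0
      squeezed = +-squeeze ∣ A ∣ (∣A·[C∪⁅c⁆]∣+∣A·C∩A·⁅c⁆∣≡∣A∣+∣A·C∣ A C c) (∣A·C∣≤∣A∣*∣C∣ A C)
        (trans packing (∣A∣*∣C∪⁅c⁆∣≡∣A∣+∣A∣*∣C∣ A c∉C))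
      C-packing : IsPacking G A C
      C-packing = proj₁ squeezed
      C-c-separated : Separated A C ⁅ c ⁆
      C-c-separated a∈A a′∈A t∈C c′∈⁅c⁆ e = contradiction
        (_ , x∈p∩q⁺ (∈·⁺ a∈A t∈C , subst (_∈ A · ⁅ c ⁆) (sym e) (∈·⁺ a′∈A c′∈⁅c⁆)))
        (∣p∣≡0⇒Empty (proj₂ squeezed))

  DisjointTranslates⇒packing : ∀ (A C : Subset n) → DisjointTranslates A C → IsPacking G A C
  DisjointTranslates⇒packing A = insertion-induction _ (λ _ → ⊥-packing A) step
    where
    step : ∀ C c → c ∉ C → (DisjointTranslates A C → IsPacking G A C)
      → DisjointTranslates A (C ∪ ⁅ c ⁆) → IsPacking G A (C ∪ ⁅ c ⁆)
    step C c c∉C ih disjoint = begin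
      ∣ A · (C ∪ ⁅ c ⁆) ∣                         ≡⟨ +-identityʳ _ ⟨
      ∣ A · (C ∪ ⁅ c ⁆) ∣ + 0                     ≡⟨ cong (∣ A · (C ∪ ⁅ c ⁆) ∣ +_) (Empty⇒∣p∣≡0 overlap-empty) ⟨
      ∣ A · (C ∪ ⁅ c ⁆) ∣ + ∣ A · C ∩ A · ⁅ c ⁆ ∣ ≡⟨ ∣A·[C∪⁅c⁆]∣+∣A·C∩A·⁅c⁆∣≡∣A∣+∣A·C∣ A C c ⟩
      ∣ A ∣ + ∣ A · C ∣                           ≡⟨ cong (∣ A ∣ +_) (ih (DisjointTranslates-⊆ (p⊆p∪q ⁅ c ⁆) disjoint)) ⟩
      ∣ A ∣ + ∣ A ∣ * ∣ C ∣                       ≡⟨ ∣A∣*∣C∪⁅c⁆∣≡∣A∣+∣A∣*∣C∣ A c∉C ⟨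
      ∣ A ∣ * ∣ C ∪ ⁅ c ⁆ ∣                       ∎
      where
      open ≡-Reasoning
      overlap-empty : Empty (A · C ∩ A · ⁅ c ⁆)
      overlap-empty (_ , y∈) with x∈p∩q⁻ (A · C) (A · ⁅ c ⁆) y∈
      ... | y∈A·C , y∈A·⁅c⁆ with ∈·⁻ y∈A·C | ∈·⁻ y∈A·⁅c⁆
      ... | _ , t , a∈A , t∈C , refl | _ , c′ , a′∈A , c′∈⁅c⁆ , e =
        c∉C (subst (_∈ C) (trans t≡c′ (x∈⁅y⁆⇒x≡y c c′∈⁅c⁆)) t∈C)
        where
        t≡c′ : t ≡ c′
        t≡c′ = disjoint a∈A a′∈A (x∈p∪q⁺ (inj₁ t∈C)) (x∈p∪q⁺ (inj₂ c′∈⁅c⁆)) e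

  collision-with-quotient-in-Diff⇒≡ : ∀ {A B a a′ c c′} → DisjointTranslates A B → a ∈ A → a′ ∈ A
    → a ∘ c ≡ a′ ∘ c′ → c ∘ inv c′ ∈ Diff G B → c ≡ c′
  collision-with-quotient-in-Diff⇒≡ {a = a} {a′} {c} {c′} B-disjoint a∈A a′∈A ac≡a′c′ q∈
    with ∈Diff⁻ q∈
  ... | b , b′ , b∈B , b′∈B , q≡bb′⁻¹ = x∙y⁻¹≈ε⇒x≈y c c′ (begin
    c ∘ inv c′    ≡⟨ q≡bb′⁻¹ ⟩
    b ∘ inv b′    ≡⟨ cong (_∘ inv b′) (B-disjoint a∈A a′∈A b∈B b′∈B ab≡a′b′) ⟩
    b′ ∘ inv b′   ≡⟨ inverseʳ b′ ⟩
    one           ∎)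
    where
    open ≡-Reasoning
    ab≡a′b′ : a ∘ b ≡ a′ ∘ b′
    ab≡a′b′ = begin
      a ∘ b                        ≡⟨ cong (a ∘_) (//-rightDividesˡ b′ b) ⟨
      a ∘ ((b ∘ inv b′) ∘ b′)      ≡⟨ cong (λ q → a ∘ (q ∘ b′)) q≡bb′⁻¹ ⟨
      a ∘ ((c ∘ inv c′) ∘ b′)      ≡⟨ assoc a (c ∘ inv c′) b′ ⟨
      (a ∘ (c ∘ inv c′)) ∘ b′      ≡⟨ cong (_∘ b′) (assoc a c (inv c′)) ⟨
      ((a ∘ c) ∘ inv c′) ∘ b′      ≡⟨ cong (λ e → (e ∘ inv c′) ∘ b′) ac≡a′c′ ⟩
      ((a′ ∘ c′) ∘ inv c′) ∘ b′    ≡⟨ cong (_∘ b′) (//-rightDividesʳ c′ a′) ⟩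
      a′ ∘ b′                      ∎

  DisjointTranslates-∪⁅x⁆· : ∀ {A B x} → DisjointTranslates A B → Stable x (Diff G B)
    → DisjointTranslates A (B ∪ ⁅ x ⁆ · B)
  DisjointTranslates-∪⁅x⁆· {A} {B} {x} B-disjoint x-stable =
    DisjointTranslates-∪ B-disjoint (DisjointTranslates-⁅x⁆· x B-disjoint) separated
    where
    separated : Separated A B (⁅ x ⁆ · B)
    separated a∈A a′∈A c∈B d∈ e with ∈⁅x⁆·⁻ d∈
    ... | t , t∈B , refl = sym (collision-with-quotient-in-Diff⇒≡ B-disjoint a′∈A a∈A (sym e)
      (subst (_∈ Diff G B) (sym (assoc x t (inv _))) (x-stable (∈Diff⁺ t∈B c∈B))))

  Stable⇒Stable-Diff : ∀ {B x} → Stable x B → Stable x (Diff G B)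
  Stable⇒Stable-Diff {B} {x} x-stable z∈ with ∈Diff⁻ z∈
  ... | b , b′ , b∈B , b′∈B , refl =
    subst (_∈ Diff G B) (assoc x b (inv b′)) (∈Diff⁺ (x-stable b∈B) b′∈B)

  Sym⊆Sym-Diff : ∀ {B} → Sym G B ⊆ Sym G (Diff G B)
  Sym⊆Sym-Diff x∈ with ∈Sym⁻ x∈
  ... | x-stable , x⁻¹-stable = ∈Sym⁺ (Stable⇒Stable-Diff x-stable) (Stable⇒Stable-Diff x⁻¹-stable)

  Stable∩Diff⇒≡one : ∀ {A B y} → DisjointTranslates A B → Nonempty B → y ∈ Diff G A → Stable y B
    → y ≡ one
  Stable∩Diff⇒≡one B-disjoint (b , b∈B) y∈ y-stable with ∈Diff⁻ y∈
  ... | a , a′ , a∈A , a′∈A , refl =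
    ∙-cancelʳ b _ one (trans yb≡b (sym (identityˡ b)))
    where
    open ≡-Reasoning
    a′∘yb≡a∘b : a′ ∘ ((a ∘ inv a′) ∘ b) ≡ a ∘ b
    a′∘yb≡a∘b = begin
      a′ ∘ ((a ∘ inv a′) ∘ b)   ≡⟨ x∙yz≈y∙xz a′ (a ∘ inv a′) b ⟩
      (a ∘ inv a′) ∘ (a′ ∘ b)   ≡⟨ assoc (a ∘ inv a′) a′ b ⟨
      ((a ∘ inv a′) ∘ a′) ∘ b   ≡⟨ cong (_∘ b) (//-rightDividesˡ a′ a) ⟩
      a ∘ b                     ∎
    yb≡b : (a ∘ inv a′) ∘ b ≡ b
    yb≡b = B-disjoint a′∈A a∈A (y-stable b∈B) b∈B a′∘yb≡a∘b

  module _ {A B : Subset n} (B-max : IsMaxPacking G A B) where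

    maxPacking-absorbs : ∀ {D} → DisjointTranslates A (B ∪ D) → D ⊆ B
    maxPacking-absorbs {D} B∪D-disjoint {y} y∈D with y ∈? B
    ... | yes y∈B = y∈B
    ... | no y∉B = contradiction
      (proj₂ B-max (B ∪ D) (DisjointTranslates⇒packing A (B ∪ D) B∪D-disjoint))
      (<⇒≱ (p⊂q⇒∣p∣<∣q∣ (p⊆p∪q D , y , x∈p∪q⁺ (inj₂ y∈D) , y∉B)))

    maxPacking-disjoint : DisjointTranslates A B
    maxPacking-disjoint = packing⇒DisjointTranslates A B (proj₁ B-max)

    maxPacking-nonempty : Nonempty B
    maxPacking-nonempty with nonempty? B
    ... | yes B-nonempty = B-nonempty
    ... | no B-empty with subst₂ _≤_ (∣⁅x⁆∣≡1 one) (Empty⇒∣p∣≡0 B-empty)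
                            (proj₂ B-max ⁅ one ⁆ (DisjointTranslates⇒packing A ⁅ one ⁆ DisjointTranslates-⁅⁆))
    ... | ()

    Stable-Diff⇒Stable : ∀ {x} → Stable x (Diff G B) → Stable x B
    Stable-Diff⇒Stable {x} x-stable y∈B =
      maxPacking-absorbs (DisjointTranslates-∪⁅x⁆· maxPacking-disjoint x-stable) (∈·⁺ (x∈⁅x⁆ x) y∈B)

    Sym≡Sym-Diff : Sym G B ≡ Sym G (Diff G B)
    Sym≡Sym-Diff = ⊆-antisym Sym⊆Sym-Diff Sym-Diff⊆Sym
      where
      Sym-Diff⊆Sym : Sym G (Diff G B) ⊆ Sym G B
      Sym-Diff⊆Sym x∈ with ∈Sym⁻ x∈
      ... | x-stable , x⁻¹-stable = ∈Sym⁺ (Stable-Diff⇒Stable x-stable) (Stable-Diff⇒Stable x⁻¹-stable)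

    Sym[Diff]∩Diff≡Sym[Diff]─Sym∪⁅one⁆ : Nonempty A
      → Sym G (Diff G A) ∩ Diff G A ≡ (Sym G (Diff G A) ─ Sym G B) ∪ ⁅ one ⁆
    Sym[Diff]∩Diff≡Sym[Diff]─Sym∪⁅one⁆ A-nonempty = ⊆-antisym ⊆∪⁅one⁆ ∪⁅one⁆⊆
      where
      ⊆∪⁅one⁆ : Sym G (Diff G A) ∩ Diff G A ⊆ (Sym G (Diff G A) ─ Sym G B) ∪ ⁅ one ⁆
      ⊆∪⁅one⁆ {y} y∈ with x∈p∩q⁻ (Sym G (Diff G A)) (Diff G A) y∈ | y ≟ one
      ... | _ | yes refl = x∈p∪q⁺ (inj₂ (x∈⁅x⁆ one))
      ... | y∈Sym[Diff] , y∈Diff | no y≢one = x∈p∪q⁺ (inj₁ (x∈p∧x∉q⇒x∈p─q y∈Sym[Diff] y∉Sym))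
        where
        y∉Sym : y ∉ Sym G B
        y∉Sym y∈Sym = y≢one (Stable∩Diff⇒≡one maxPacking-disjoint maxPacking-nonempty y∈Diff (proj₁ (∈Sym⁻ y∈Sym)))
      ∪⁅one⁆⊆ : (Sym G (Diff G A) ─ Sym G B) ∪ ⁅ one ⁆ ⊆ Sym G (Diff G A) ∩ Diff G A
      ∪⁅one⁆⊆ y∈ with x∈p∪q⁻ (Sym G (Diff G A) ─ Sym G B) ⁅ one ⁆ y∈
      ... | inj₁ y∈Sym[Diff]─Sym =
        let y∈Sym[Diff] = p─q⊆p _ _ y∈Sym[Diff]─Sym
        in x∈p∩q⁺ (y∈Sym[Diff] , Stable⇒∈ (proj₁ (∈Sym⁻ y∈Sym[Diff])) (one∈Diff A-nonempty))
      ... | inj₂ y∈⁅one⁆ = subst (_∈ Sym G (Diff G A) ∩ Diff G A) (sym (x∈⁅y⁆⇒x≡y one y∈⁅one⁆))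
        (x∈p∩q⁺ (one∈Sym (Diff G A) , one∈Diff A-nonempty))

mainTheorem4 : {n : ℕ} (G : FinAbGroup n) (A B : Subset n)
    → Nonempty A
    → IsMaxPacking G A B
    → (Sym G B ≡ Sym G (Diff G B))
      × ((Sym G (Diff G A) ∩ Diff G A ≡ (Sym G (Diff G A) ─ Sym G B) ∪ ⁅ FinAbGroup.one G ⁆)
         × Disjoint G (Sym G (Diff G A) ─ Sym G B) ⁅ FinAbGroup.one G ⁆)
mainTheorem4 G A B A-nonempty B-max =
    Sym≡Sym-Diff G B-max
  , Sym[Diff]∩Diff≡Sym[Diff]─Sym∪⁅one⁆ G B-max A-nonempty
  , x∈q⇒Empty[p─q∩⁅x⁆] (Sym G (Diff G A)) (Sym G B) (one∈Sym G B)
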